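{- Let $t$ be a positive integer and let $\Psi$ be a $t$-quasiarc in $\mathrm{PG}(2,q)$. If there exists a line $\ell$ with $|\ell\cap\Psi|=k$, then \[ |\Psi|\leq k+\frac{(q+1-k)q}{t}. \]
   Context: $\mathrm{PG}(2,q)$ is the classical projective plane of order $q$. For a point set $\Psi$ and a point $P\in\Psi$, a tangent to $\Psi$ through $P$ is a line meeting $\Psi$ exactly in $P$. A set $\Psi$ of points is a $t$-quasiarc if through every point $P\in\Psi$ there are at least $t$ tangents to $\Psi$. -}

module Defs where

open import Level using (Level; _⊔_) renaming (suc to lsuc)
open import Algebra.Bundles using (CommutativeRing)
open import Data.Nat using (ℕ)
open import Data.Product using (Σ; ∃; _×_; _,_; proj₁)
open import Data.List using (List; length; filter)
open import Data.List.Relation.Unary.Any using (Any)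
open import Data.List.Relation.Unary.All using (All)
open import Data.List.Relation.Unary.AllPairs using (AllPairs)
open import Data.List.Membership.Propositional using (_∈_)
open import Relation.Nullary using (¬_; Dec)
open import Relation.Binary using (Decidable)
open import Relation.Binary.PropositionalEquality using (_≡_)

record FiniteField (c ℓ : Level) : Set (lsuc (c ⊔ ℓ)) where
  field
    cring : CommutativeRing c ℓ
  open CommutativeRing cring public
  field
    _≟_      : Decidable _≈_
    1≉0      : ¬ (1# ≈ 0#)
    inverse  : ∀ x → ¬ (x ≈ 0#) → ∃ λ y → x * y ≈ 1#
    elements : List Carrier
    complete : ∀ x → Any (x ≈_) elements
    distinct : AllPairs (λ x y → ¬ (x ≈ y)) elements

  order : ℕ
  order = length elements

module PG {c ℓ : Level} (F : FiniteField c ℓ) where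
  open FiniteField F

  Vec3 : Set c
  Vec3 = Carrier × Carrier × Carrier

  IsZero : Vec3 → Set ℓ
  IsZero (x , y , z) = (x ≈ 0#) × (y ≈ 0#) × (z ≈ 0#)

  -- points of PG(2,q): nonzero vectors of F^3, taken up to nonzero scalars
  Point : Set (c ⊔ ℓ)
  Point = Σ Vec3 λ v → ¬ IsZero v

  -- lines of PG(2,q): nonzero (dual) coordinate vectors, up to nonzero scalars
  Line : Set (c ⊔ ℓ)
  Line = Point

  _≋_ : Point → Point → Set (c ⊔ ℓ)
  ((x , y , z) , _) ≋ ((x' , y' , z') , _) =
    ∃ λ λ' → ¬ (λ' ≈ 0#) × (x ≈ λ' * x') × (y ≈ λ' * y') × (z ≈ λ' * z')

  dot : Vec3 → Vec3 → Carrier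
  dot (a , b , c') (x , y , z) = a * x + b * y + c' * z

  _∈ₗ_ : Point → Line → Set ℓ
  P ∈ₗ L = dot (proj₁ L) (proj₁ P) ≈ 0#

  _∈ₗ?_ : ∀ P L → Dec (P ∈ₗ L)
  P ∈ₗ? L = dot (proj₁ L) (proj₁ P) ≟ 0#

  record PointSet : Set (c ⊔ ℓ) where
    field
      pts  : List Point
      uniq : AllPairs (λ P Q → ¬ (P ≋ Q)) pts
  open PointSet public

  card : PointSet → ℕ
  card Ψ = length (pts Ψ)

  meet : Line → PointSet → ℕ
  meet L Ψ = length (filter (λ P → P ∈ₗ? L) (pts Ψ))

  Tangent : PointSet → Point → Line → Set (c ⊔ ℓ)
  Tangent Ψ P L = (P ∈ₗ L) × (∀ Q → Q ∈ pts Ψ → Q ∈ₗ L → Q ≋ P)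

  Quasiarc : ℕ → PointSet → Set (c ⊔ ℓ)
  Quasiarc t Ψ = ∀ P → P ∈ pts Ψ →
    ∃ λ (Ls : List Line) → (length Ls ≡ t) × AllPairs (λ L M → ¬ (L ≋ M)) Ls
                         × All (Tangent Ψ P) Ls

-- Count pairwise distinct lines of PG(2,q); there are at most q² + q + 1 of them, since a
-- line is determined by its normalised coordinates. Besides ℓ, take the q other lines
-- through each of the k points of ℓ ∩ Ψ, and the t tangents at each of the |Ψ| − k points
-- of Ψ off ℓ. A tangent at P meets Ψ only in P, so it is neither a tangent at another point
-- nor a line through a point of ℓ ∩ Ψ; lines other than ℓ through different points of ℓ
-- differ because two lines meet in at most one point. Hence 1 + kq + (|Ψ| − k)t ≤ q² + q + 1,
-- which rearranges to the bound.
module Submission where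

open import Level using (Level; _⊔_)
open import Algebra.Bundles using (CommutativeRing)
open import Data.Bool using (true; false; if_then_else_)
open import Data.Empty using (⊥-elim)
open import Data.Fin as Fin using (Fin; zero; suc)
open import Data.Fin.Properties using (pigeonhole; +↔⊎; *↔×)
open import Data.List using (List; []; _∷_; _++_; length; lookup; map; filter)
open import Data.List.Properties using (length-++; length-map)
open import Data.List.Membership.Propositional using (_∈_)
open import Data.List.Membership.Propositional.Properties using (∈-lookup)
open import Data.List.Relation.Unary.All as All using (All; []; _∷_)
import Data.List.Relation.Unary.All.Properties as All
open import Data.List.Relation.Unary.AllPairs as AllPairs using (AllPairs; []; _∷_)
import Data.List.Relation.Unary.AllPairs.Properties as AllPairs
import Data.List.Relation.Unary.Any as Any
open import Data.List.Relation.Unary.Any.Properties using (lookup-index)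
open import Data.Nat as ℕ using (ℕ; zero; suc)
import Data.Nat.Properties as ℕ
open import Data.Nat.ListAction using (sum)
open import Data.Nat.Tactic.RingSolver using (solve-∀)
open import Data.Product using (Σ; ∃; _×_; _,_; proj₁; proj₂)
open import Data.Sum using (_⊎_; inj₁; inj₂; [_,_])
open import Data.Sum.Function.Propositional using (_⊎-↔_)
open import Data.Unit using (tt)
open import Function using (_∘_; _↔_; Injection)
open import Function.Construct.Composition using (_↔-∘_)
open import Function.Construct.Symmetry using (↔-sym)
open import Function.Properties.Inverse using (↔⇒↣)
open import Relation.Binary using (Rel)
open import Relation.Binary.PropositionalEquality as ≡ using (_≡_; _≢_)
open import Relation.Nullary using (¬_; Dec; yes; no; does)
open import Relation.Nullary.Decidable using (_×-dec_)
open import Relation.Unary using (Pred; Decidable)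

open import Defs

module _ {a r : Level} {A : Set a} {R : Rel A r} where

  AllPairs-lookup : ∀ {xs} → AllPairs R xs → ∀ {i j} → i Fin.< j → R (lookup xs i) (lookup xs j)
  AllPairs-lookup (Rx ∷ _)   {zero}  {suc j} _            = All.lookup Rx (∈-lookup j)
  AllPairs-lookup (_  ∷ Rxs) {suc i} {suc j} (ℕ.s≤s i<j) = AllPairs-lookup Rxs i<j

  AllPairs-length≤ : ∀ {n} (f : A → Fin n) → (∀ {x y} → R x y → f x ≢ f y)
                   → ∀ {xs} → AllPairs R xs → length xs ℕ.≤ n
  AllPairs-length≤ {n} f separates {xs} Rxs with length xs ℕ.≤? n
  ... | yes ≤n = ≤n
  ... | no  ≰n with pigeonhole (ℕ.≰⇒> ≰n) (f ∘ lookup xs)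
  ...   | i , j , i<j , fi≡fj = ⊥-elim (separates (AllPairs-lookup Rxs i<j) fi≡fj)

module Gathering {a b r s o : Level} {A : Set a} {B : Set b}
                 (R : Rel A r) (S : Rel B s) (Owns : A → B → Set o) (weight : A → ℕ) where

  Family : A → Set (b ⊔ s ⊔ o)
  Family x = Σ (List B) λ bs → length bs ≡ weight x × AllPairs S bs × All (Owns x) bs

  gather : ∀ {xs} → All Family xs → List B
  gather []              = []
  gather ((bs , _) ∷ fs) = bs ++ gather fs

  length-gather : ∀ {xs} (fs : All Family xs) → length (gather fs) ≡ sum (map weight xs)
  length-gather []                     = ≡.refl
  length-gather ((bs , |bs|≡w , _) ∷ fs) =
    ≡.trans (length-++ bs) (≡.cong₂ ℕ._+_ |bs|≡w (length-gather fs))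

  gather-All : ∀ {p q} {P : A → Set p} {Q : B → Set q} → (∀ {x b} → P x → Owns x b → Q b)
             → ∀ {xs} → All P xs → (fs : All Family xs) → All Q (gather fs)
  gather-All owned⇒Q []         []                      = []
  gather-All owned⇒Q (Px ∷ Pxs) ((_ , _ , _ , owned) ∷ fs) =
    All.++⁺ (All.map (owned⇒Q Px) owned) (gather-All owned⇒Q Pxs fs)

  gather-AllPairs : (∀ {x y b c} → R x y → Owns x b → Owns y c → S b c)
                  → ∀ {xs} → AllPairs R xs → (fs : All Family xs) → AllPairs S (gather fs)
  gather-AllPairs separate []         []                        = []
  gather-AllPairs separate (Rx ∷ Rxs) ((_ , _ , Sbs , owned) ∷ fs) =
    AllPairs.++⁺ Sbs (gather-AllPairs separate Rxs fs)
      (All.map (λ owns-b → gather-All (λ Rxy owns-c → separate Rxy owns-b owns-c) Rx fs) owned)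

-- The ring solver needs coefficients that compute; for an abstract ring these are the
-- integers, mapped in by the canonical homomorphism ℤ → R.
module IntegerCoefficients {c ℓ : Level} (R : CommutativeRing c ℓ) where
  open import Data.Integer as ℤ using (ℤ; +_; -[1+_])
  import Data.Integer.Properties as ℤ
  open import Data.Maybe using (Maybe; just; nothing)
  open import Data.Sign as Sign using (Sign)
  open CommutativeRing R
  open import Algebra.Properties.Ring ring using (-0#≈0#; -1*x≈-x; -‿involutive; -‿+-comm)
  open import Algebra.Properties.Semiring.Mult.TCOptimised semiring
    using (×-homo-+; ×1-homo-*; 1+×) renaming (_×_ to _×′_)
  open import Algebra.Properties.CommutativeSemigroup *-commutativeSemigroup
    using () renaming (interchange to *-interchange)
  open import Algebra.Properties.CommutativeSemigroup +-commutativeSemigroup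
    using () renaming (interchange to +-interchange)
  import Algebra.Solver.Ring.AlmostCommutativeRing as ACR
  open import Relation.Binary.Reasoning.Setoid setoid

  private
    ⟦_⟧ : ℤ → Carrier
    ⟦ + n ⟧      = n ×′ 1#
    ⟦ -[1+ n ] ⟧ = - (suc n ×′ 1#)

    ⟦_⟧ₛ : Sign → Carrier
    ⟦ Sign.+ ⟧ₛ = 1#
    ⟦ Sign.- ⟧ₛ = - 1#

    ⟦⟧≈sign*abs : ∀ i → ⟦ i ⟧ ≈ ⟦ ℤ.sign i ⟧ₛ * (ℤ.∣ i ∣ ×′ 1#)
    ⟦⟧≈sign*abs (+ n)      = sym (*-identityˡ _)
    ⟦⟧≈sign*abs -[1+ n ] = sym (-1*x≈-x _)

    ⟦◃⟧ : ∀ s n → ⟦ s ℤ.◃ n ⟧ ≈ ⟦ s ⟧ₛ * (n ×′ 1#)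
    ⟦◃⟧ s        zero    = sym (zeroʳ ⟦ s ⟧ₛ)
    ⟦◃⟧ Sign.+ (suc n) = sym (*-identityˡ _)
    ⟦◃⟧ Sign.- (suc n) = sym (-1*x≈-x _)

    ⟦⟧ₛ-homo : ∀ s s′ → ⟦ s Sign.* s′ ⟧ₛ ≈ ⟦ s ⟧ₛ * ⟦ s′ ⟧ₛ
    ⟦⟧ₛ-homo Sign.+ Sign.+ = sym (*-identityˡ _)
    ⟦⟧ₛ-homo Sign.+ Sign.- = sym (*-identityˡ _)
    ⟦⟧ₛ-homo Sign.- Sign.+ = sym (*-identityʳ _)
    ⟦⟧ₛ-homo Sign.- Sign.- = sym (trans (-1*x≈-x (- 1#)) (-‿involutive 1#))

    *-homo : ∀ i j → ⟦ i ℤ.* j ⟧ ≈ ⟦ i ⟧ * ⟦ j ⟧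
    *-homo i j = begin
      ⟦ i ℤ.* j ⟧
        ≈⟨ ⟦◃⟧ (ℤ.sign i Sign.* ℤ.sign j) (ℤ.∣ i ∣ ℕ.* ℤ.∣ j ∣) ⟩
      ⟦ ℤ.sign i Sign.* ℤ.sign j ⟧ₛ * ((ℤ.∣ i ∣ ℕ.* ℤ.∣ j ∣) ×′ 1#)
        ≈⟨ *-cong (⟦⟧ₛ-homo (ℤ.sign i) (ℤ.sign j)) (×1-homo-* ℤ.∣ i ∣ ℤ.∣ j ∣) ⟩
      (⟦ ℤ.sign i ⟧ₛ * ⟦ ℤ.sign j ⟧ₛ) * ((ℤ.∣ i ∣ ×′ 1#) * (ℤ.∣ j ∣ ×′ 1#))
        ≈⟨ *-interchange _ _ _ _ ⟩
      (⟦ ℤ.sign i ⟧ₛ * (ℤ.∣ i ∣ ×′ 1#)) * (⟦ ℤ.sign j ⟧ₛ * (ℤ.∣ j ∣ ×′ 1#))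
        ≈⟨ *-cong (⟦⟧≈sign*abs i) (⟦⟧≈sign*abs j) ⟨
      ⟦ i ⟧ * ⟦ j ⟧ ∎

    ⊖-homo : ∀ m n → ⟦ m ℤ.⊖ n ⟧ ≈ m ×′ 1# - n ×′ 1#
    ⊖-homo zero    zero    = sym (trans (+-congˡ -0#≈0#) (+-identityˡ 0#))
    ⊖-homo (suc m) zero    = sym (trans (+-congˡ -0#≈0#) (+-identityʳ _))
    ⊖-homo zero    (suc n) = sym (+-identityˡ _)
    ⊖-homo (suc m) (suc n) = begin
      ⟦ suc m ℤ.⊖ suc n ⟧                 ≡⟨ ≡.cong ⟦_⟧ (ℤ.[1+m]⊖[1+n]≡m⊖n m n) ⟩
      ⟦ m ℤ.⊖ n ⟧                         ≈⟨ ⊖-homo m n ⟩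
      m ×′ 1# - n ×′ 1#                   ≈⟨ +-identityˡ _ ⟨
      0# + (m ×′ 1# - n ×′ 1#)            ≈⟨ +-congʳ (-‿inverseʳ 1#) ⟨
      (1# - 1#) + (m ×′ 1# - n ×′ 1#)     ≈⟨ +-interchange _ _ _ _ ⟩
      (1# + m ×′ 1#) + (- 1# - n ×′ 1#)   ≈⟨ +-congˡ (-‿+-comm 1# (n ×′ 1#)) ⟩
      (1# + m ×′ 1#) - (1# + n ×′ 1#)     ≈⟨ +-cong (1+× m 1#) (-‿cong (1+× n 1#)) ⟨
      suc m ×′ 1# - suc n ×′ 1#           ∎

    +-homo : ∀ i j → ⟦ i ℤ.+ j ⟧ ≈ ⟦ i ⟧ + ⟦ j ⟧
    +-homo (+ m)      (+ n)      = ×-homo-+ 1# m n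
    +-homo (+ m)      -[1+ n ] = ⊖-homo m (suc n)
    +-homo -[1+ m ] (+ n)      = trans (⊖-homo n (suc m)) (+-comm _ _)
    +-homo -[1+ m ] -[1+ n ] = begin
      - (suc (suc (m ℕ.+ n)) ×′ 1#)       ≡⟨ ≡.cong (λ k → - (suc k ×′ 1#)) (ℕ.+-suc m n) ⟨
      - ((suc m ℕ.+ suc n) ×′ 1#)         ≈⟨ -‿cong (×-homo-+ 1# (suc m) (suc n)) ⟩
      - (suc m ×′ 1# + suc n ×′ 1#)       ≈⟨ -‿+-comm _ _ ⟨
      - (suc m ×′ 1#) - suc n ×′ 1#       ∎

    -‿homo : ∀ i → ⟦ ℤ.- i ⟧ ≈ - ⟦ i ⟧
    -‿homo (+ zero)   = sym -0#≈0#
    -‿homo (+ suc n)  = refl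
    -‿homo -[1+ n ] = sym (-‿involutive _)

    homomorphism : ℤ.+-*-rawRing ACR.-Raw-AlmostCommutative⟶ ACR.fromCommutativeRing R
    homomorphism = record
      { ⟦_⟧ = ⟦_⟧ ; +-homo = +-homo ; *-homo = *-homo ; -‿homo = -‿homo
      ; 0-homo = refl ; 1-homo = refl }

    ⟦⟧-equal? : ∀ i j → Maybe (⟦ i ⟧ ≈ ⟦ j ⟧)
    ⟦⟧-equal? i j with i ℤ.≟ j
    ... | yes ≡.refl = just refl
    ... | no _       = nothing

  open import Algebra.Solver.Ring ℤ.+-*-rawRing (ACR.fromCommutativeRing R) homomorphism ⟦⟧-equal? public

module Vector3 {c ℓ : Level} (R : CommutativeRing c ℓ) where
  open CommutativeRing R
  open IntegerCoefficients R
  open import Data.Integer using (+_)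

  -- With R the ring of a field, _·_, (_≈ᵥ 0ᵥ) and the _∥_ defined later unfold to the
  -- PG.dot, PG.IsZero and PG._≋_ of Defs, so these lemmas apply to points and lines as they are.
  Vec3 : Set c
  Vec3 = Carrier × Carrier × Carrier

  infix  4 _≈ᵥ_
  infixl 6 _+ᵥ_ _-ᵥ_
  infixr 7 _*ᵥ_
  infix  7 _·_ _⨯_

  _≈ᵥ_ : Vec3 → Vec3 → Set ℓ
  (x , y , z) ≈ᵥ (x′ , y′ , z′) = x ≈ x′ × y ≈ y′ × z ≈ z′

  0ᵥ : Vec3
  0ᵥ = 0# , 0# , 0#

  _*ᵥ_ : Carrier → Vec3 → Vec3
  k *ᵥ (x , y , z) = k * x , k * y , k * z

  _+ᵥ_ : Vec3 → Vec3 → Vec3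
  (x , y , z) +ᵥ (x′ , y′ , z′) = x + x′ , y + y′ , z + z′

  _-ᵥ_ : Vec3 → Vec3 → Vec3
  (x , y , z) -ᵥ (x′ , y′ , z′) = x - x′ , y - y′ , z - z′

  _·_ : Vec3 → Vec3 → Carrier
  (a , b , c) · (x , y , z) = a * x + b * y + c * z

  _⨯_ : Vec3 → Vec3 → Vec3
  (a , b , c) ⨯ (x , y , z) = b * z - c * y , c * x - a * z , a * y - b * x

  ≈ᵥ-refl : ∀ {u} → u ≈ᵥ u
  ≈ᵥ-refl = refl , refl , refl

  ≈ᵥ-sym : ∀ {u v} → u ≈ᵥ v → v ≈ᵥ u
  ≈ᵥ-sym (p , q , r) = sym p , sym q , sym r

  ≈ᵥ-trans : ∀ {u v w} → u ≈ᵥ v → v ≈ᵥ w → u ≈ᵥ w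
  ≈ᵥ-trans (p , q , r) (p′ , q′ , r′) = trans p p′ , trans q q′ , trans r r′

  ·-cong : ∀ {u u′ v v′} → u ≈ᵥ u′ → v ≈ᵥ v′ → u · v ≈ u′ · v′
  ·-cong (p , q , r) (p′ , q′ , r′) = +-cong (+-cong (*-cong p p′) (*-cong q q′)) (*-cong r r′)

  private
    infixl 6 _+ₚ_ _-ₚ_
    infixr 7 _*ₚ_
    infix  9 _·ₚ_ _⨯ₚ_

    Vecₚ : ℕ → Set
    Vecₚ n = Polynomial n × Polynomial n × Polynomial n

    _*ₚ_ : ∀ {n} → Polynomial n → Vecₚ n → Vecₚ n
    k *ₚ (x , y , z) = k :* x , k :* y , k :* z

    _+ₚ_ _-ₚ_ _⨯ₚ_ : ∀ {n} → Vecₚ n → Vecₚ n → Vecₚ n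
    (x , y , z) +ₚ (x′ , y′ , z′) = x :+ x′ , y :+ y′ , z :+ z′
    (x , y , z) -ₚ (x′ , y′ , z′) = x :- x′ , y :- y′ , z :- z′
    (a , b , c) ⨯ₚ (x , y , z) = b :* z :- c :* y , c :* x :- a :* z , a :* y :- b :* x

    _·ₚ_ : ∀ {n} → Vecₚ n → Vecₚ n → Polynomial n
    (a , b , c) ·ₚ (x , y , z) = a :* x :+ b :* y :+ c :* z

  ·-comm : ∀ u v → u · v ≈ v · u
  ·-comm (a , b , c) (x , y , z) =
    solve 6 (λ a b c x y z → (a , b , c) ·ₚ (x , y , z) := (x , y , z) ·ₚ (a , b , c)) refl a b c x y z

  ·-*ᵥˡ : ∀ k u v → (k *ᵥ u) · v ≈ k * (u · v)
  ·-*ᵥˡ k (a , b , c) (x , y , z) =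
    solve 7 (λ k a b c x y z → (k *ₚ (a , b , c)) ·ₚ (x , y , z) := k :* ((a , b , c) ·ₚ (x , y , z)))
      refl k a b c x y z

  ·-*ᵥʳ : ∀ k u v → u · (k *ᵥ v) ≈ k * (u · v)
  ·-*ᵥʳ k (a , b , c) (x , y , z) =
    solve 7 (λ k a b c x y z → (a , b , c) ·ₚ (k *ₚ (x , y , z)) := k :* ((a , b , c) ·ₚ (x , y , z)))
      refl k a b c x y z

  ·-+ᵥˡ : ∀ u v w → (u +ᵥ v) · w ≈ u · w + v · w
  ·-+ᵥˡ (a , b , c) (a′ , b′ , c′) (x , y , z) =
    solve 9 (λ a b c a′ b′ c′ x y z → ((a , b , c) +ₚ (a′ , b′ , c′)) ·ₚ (x , y , z)
                                       := (a , b , c) ·ₚ (x , y , z) :+ (a′ , b′ , c′) ·ₚ (x , y , z))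
      refl a b c a′ b′ c′ x y z

  0ᵥ-· : ∀ u → 0ᵥ · u ≈ 0#
  0ᵥ-· (x , y , z) =
    solve 3 (λ x y z → (con (+ 0) , con (+ 0) , con (+ 0)) ·ₚ (x , y , z) := con (+ 0)) refl x y z

  ⨯-orthogonalˡ : ∀ u v → (u ⨯ v) · u ≈ 0#
  ⨯-orthogonalˡ (a , b , c) (x , y , z) =
    solve 6 (λ a b c x y z → ((a , b , c) ⨯ₚ (x , y , z)) ·ₚ (a , b , c) := con (+ 0)) refl a b c x y z

  ⨯-orthogonalʳ : ∀ u v → (u ⨯ v) · v ≈ 0#
  ⨯-orthogonalʳ (a , b , c) (x , y , z) =
    solve 6 (λ a b c x y z → ((a , b , c) ⨯ₚ (x , y , z)) ·ₚ (x , y , z) := con (+ 0)) refl a b c x y z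

  ⨯-⨯ : ∀ u v w → (u ⨯ v) ⨯ w ≈ᵥ (w · u) *ᵥ v -ᵥ (w · v) *ᵥ u
  ⨯-⨯ (a , b , c) (x , y , z) (p , q , r) =
      solve 9 (λ a b c x y z p q r → proj₁ (lhs (a , b , c) (x , y , z) (p , q , r))
                                     := proj₁ (rhs (a , b , c) (x , y , z) (p , q , r))) refl a b c x y z p q r
    , solve 9 (λ a b c x y z p q r → proj₁ (proj₂ (lhs (a , b , c) (x , y , z) (p , q , r)))
                                     := proj₁ (proj₂ (rhs (a , b , c) (x , y , z) (p , q , r)))) refl a b c x y z p q r
    , solve 9 (λ a b c x y z p q r → proj₂ (proj₂ (lhs (a , b , c) (x , y , z) (p , q , r)))
                                     := proj₂ (proj₂ (rhs (a , b , c) (x , y , z) (p , q , r)))) refl a b c x y z p q r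
    where
    lhs rhs : ∀ {n} → Vecₚ n → Vecₚ n → Vecₚ n → Vecₚ n
    lhs u v w = (u ⨯ₚ v) ⨯ₚ w
    rhs u v w = (w ·ₚ u) *ₚ v -ₚ (w ·ₚ v) *ₚ u

module FieldVectors {c ℓ : Level} (F : FiniteField c ℓ) where
  open FiniteField F
  open IntegerCoefficients cring using (solve; _:=_; _:+_; _:*_; _:-_; con)
  open import Data.Integer using (+_)
  open Vector3 cring
  open import Algebra.Properties.Group +-group using (x∙y⁻¹≈ε⇒x≈y; x≈y⇒x∙y⁻¹≈ε)
  open import Relation.Binary.Reasoning.Setoid setoid

  x-y≈0⇒x≈y : ∀ {x y} → x - y ≈ 0# → x ≈ y
  x-y≈0⇒x≈y = x∙y⁻¹≈ε⇒x≈y _ _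

  x≈y⇒x-y≈0 : ∀ {x y} → x ≈ y → x - y ≈ 0#
  x≈y⇒x-y≈0 = x≈y⇒x∙y⁻¹≈ε

  x*x′≈1⇒y≈x′*[x*y] : ∀ {x x′} y → x * x′ ≈ 1# → y ≈ x′ * (x * y)
  x*x′≈1⇒y≈x′*[x*y] {x} {x′} y xx′≈1 = begin
    y             ≈⟨ *-identityˡ y ⟨
    1# * y        ≈⟨ *-congʳ xx′≈1 ⟨
    (x * x′) * y  ≈⟨ solve 3 (λ x x′ y → (x :* x′) :* y := x′ :* (x :* y)) refl x x′ y ⟩
    x′ * (x * y)  ∎

  x*y≈0⇒y≈0 : ∀ {x y} → ¬ x ≈ 0# → x * y ≈ 0# → y ≈ 0#
  x*y≈0⇒y≈0 {x} {y} x≉0 xy≈0 = begin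
    y             ≈⟨ x*x′≈1⇒y≈x′*[x*y] y (proj₂ (inverse x x≉0)) ⟩
    x′ * (x * y)  ≈⟨ *-congˡ xy≈0 ⟩
    x′ * 0#       ≈⟨ zeroʳ x′ ⟩
    0#            ∎
    where x′ = proj₁ (inverse x x≉0)

  x*y≈0⇒x≈0 : ∀ {x y} → ¬ y ≈ 0# → x * y ≈ 0# → x ≈ 0#
  x*y≈0⇒x≈0 {x} {y} y≉0 xy≈0 = x*y≈0⇒y≈0 y≉0 (trans (*-comm y x) xy≈0)

  *-nonzero : ∀ {x y} → ¬ x ≈ 0# → ¬ y ≈ 0# → ¬ x * y ≈ 0#
  *-nonzero x≉0 y≉0 xy≈0 = y≉0 (x*y≈0⇒y≈0 x≉0 xy≈0)

  inverse-nonzero : ∀ {x x′} → x * x′ ≈ 1# → ¬ x′ ≈ 0#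
  inverse-nonzero {x} {x′} xx′≈1 x′≈0 = 1≉0 (begin
    1#       ≈⟨ xx′≈1 ⟨
    x * x′   ≈⟨ *-congˡ x′≈0 ⟩
    x * 0#   ≈⟨ zeroʳ x ⟩
    0#       ∎)

  zero-combination : ∀ {a b} x y → a ≈ 0# → b ≈ 0# → a * x - b * y ≈ 0#
  zero-combination x y a≈0 b≈0 =
    trans (+-cong (*-congʳ a≈0) (-‿cong (*-congʳ b≈0)))
          (solve 2 (λ x y → con (+ 0) :* x :- con (+ 0) :* y := con (+ 0)) refl x y)

  IsZero? : ∀ v → Dec (v ≈ᵥ 0ᵥ)
  IsZero? (x , y , z) = x ≟ 0# ×-dec y ≟ 0# ×-dec z ≟ 0#

  zero-multiple : ∀ {u v d} → d ≈ 0# → u ≈ᵥ d *ᵥ v → u ≈ᵥ 0ᵥ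
  zero-multiple d≈0 (p , q , r) = vanish p , vanish q , vanish r
    where
    vanish : ∀ {a b} → a ≈ _ * b → a ≈ 0#
    vanish {b = b} a≈db = trans a≈db (trans (*-congʳ d≈0) (zeroˡ b))

  *ᵥ-zero : ∀ {u s} → ¬ u ≈ᵥ 0ᵥ → s *ᵥ u ≈ᵥ 0ᵥ → s ≈ 0#
  *ᵥ-zero {u} {s} u≉0 (p , q , r) with s ≟ 0#
  ... | yes s≈0 = s≈0
  ... | no  s≉0 = ⊥-elim (u≉0 (x*y≈0⇒y≈0 s≉0 p , x*y≈0⇒y≈0 s≉0 q , x*y≈0⇒y≈0 s≉0 r))

  ·-basis : ∀ x y z → (1# , 0# , 0#) · (x , y , z) ≈ x
                    × (0# , 1# , 0#) · (x , y , z) ≈ y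
                    × (0# , 0# , 1#) · (x , y , z) ≈ z
  ·-basis x y z =
      solve 3 (λ x y z → con (+ 1) :* x :+ con (+ 0) :* y :+ con (+ 0) :* z := x) refl x y z
    , solve 3 (λ x y z → con (+ 0) :* x :+ con (+ 1) :* y :+ con (+ 0) :* z := y) refl x y z
    , solve 3 (λ x y z → con (+ 0) :* x :+ con (+ 0) :* y :+ con (+ 1) :* z := z) refl x y z

  nonorthogonal : ∀ v → ¬ v ≈ᵥ 0ᵥ → ∃ λ e → ¬ e · v ≈ 0#
  nonorthogonal v@(x , y , z) v≉0
    with ((1# , 0# , 0#) · v) ≟ 0# | ((0# , 1# , 0#) · v) ≟ 0# | ((0# , 0# , 1#) · v) ≟ 0#
  ... | no e·v≉0 | _        | _        = _ , e·v≉0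
  ... | yes _    | no e·v≉0 | _        = _ , e·v≉0
  ... | yes _    | yes _    | no e·v≉0 = _ , e·v≉0
  ... | yes p    | yes q    | yes r    = ⊥-elim (v≉0 (trans (sym x≈) p , trans (sym y≈) q , trans (sym z≈) r))
    where
    x≈ = proj₁ (·-basis x y z)
    y≈ = proj₁ (proj₂ (·-basis x y z))
    z≈ = proj₂ (proj₂ (·-basis x y z))

  ⨯-zeroˡ : ∀ {u w} → u ≈ᵥ 0ᵥ → u ⨯ w ≈ᵥ 0ᵥ
  ⨯-zeroˡ {w = x , y , z} (p , q , r) =
    zero-combination z y q r , zero-combination x z r p , zero-combination y x p q

  ⨯-zero⇒multiple : ∀ u v → u ⨯ v ≈ᵥ 0ᵥ → ¬ v ≈ᵥ 0ᵥ → ∃ λ d → u ≈ᵥ d *ᵥ v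
  ⨯-zero⇒multiple u v u⨯v≈0 v≉0 =
    let p , q , r = ≈ᵥ-trans (≈ᵥ-sym (⨯-⨯ u v e)) (⨯-zeroˡ u⨯v≈0)
    in  b′ * (e · u) , solve-for p , solve-for q , solve-for r
    where
    e = proj₁ (nonorthogonal v v≉0)
    b′ = proj₁ (inverse (e · v) (proj₂ (nonorthogonal v v≉0)))
    bb′≈1 = proj₂ (inverse (e · v) (proj₂ (nonorthogonal v v≉0)))
    solve-for : ∀ {x y} → (e · u) * y - (e · v) * x ≈ 0# → x ≈ (b′ * (e · u)) * y
    solve-for {x} {y} h = begin
      x                     ≈⟨ x*x′≈1⇒y≈x′*[x*y] x bb′≈1 ⟩
      b′ * ((e · v) * x)    ≈⟨ *-congˡ (x-y≈0⇒x≈y h) ⟨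
      b′ * ((e · u) * y)    ≈⟨ *-assoc b′ (e · u) y ⟨
      (b′ * (e · u)) * y    ∎

  infix 4 _∥_
  _∥_ : Vec3 → Vec3 → Set (c ⊔ ℓ)
  u ∥ v = ∃ λ μ → ¬ μ ≈ 0# × u ≈ᵥ μ *ᵥ v

  multiple⇒∥ : ∀ {u v} → ¬ u ≈ᵥ 0ᵥ → (∃ λ d → u ≈ᵥ d *ᵥ v) → u ∥ v
  multiple⇒∥ u≉0 (d , u≈dv) = d , (λ d≈0 → u≉0 (zero-multiple d≈0 u≈dv)) , u≈dv

  ∥-sym : ∀ {u v} → u ∥ v → v ∥ u
  ∥-sym (μ , μ≉0 , p , q , r) = μ′ , inverse-nonzero μμ′≈1 , back p , back q , back r
    where
    μ′ = proj₁ (inverse μ μ≉0)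
    μμ′≈1 = proj₂ (inverse μ μ≉0)
    back : ∀ {a b} → a ≈ μ * b → b ≈ μ′ * a
    back {a} {b} a≈μb = trans (x*x′≈1⇒y≈x′*[x*y] b μμ′≈1) (*-congˡ (sym a≈μb))

  ∥-trans : ∀ {u v w} → u ∥ v → v ∥ w → u ∥ w
  ∥-trans (μ , μ≉0 , p , q , r) (ν , ν≉0 , p′ , q′ , r′) =
    μ * ν , *-nonzero μ≉0 ν≉0 , compose p p′ , compose q q′ , compose r r′
    where
    compose : ∀ {a b c} → a ≈ μ * b → b ≈ ν * c → a ≈ (μ * ν) * c
    compose {c = c} a≈μb b≈νc = trans a≈μb (trans (*-congˡ b≈νc) (sym (*-assoc μ ν c)))

  ·-zero-respˡ-∥ : ∀ {l m p} → l ∥ m → l · p ≈ 0# → m · p ≈ 0#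
  ·-zero-respˡ-∥ {l} {m} {p} l∥m l·p≈0 with ∥-sym l∥m
  ... | μ , _ , m≈μl = begin
    m · p          ≈⟨ ·-cong m≈μl ≈ᵥ-refl ⟩
    (μ *ᵥ l) · p   ≈⟨ ·-*ᵥˡ μ l p ⟩
    μ * (l · p)    ≈⟨ *-congˡ l·p≈0 ⟩
    μ * 0#         ≈⟨ zeroʳ μ ⟩
    0#             ∎

  common-normal⇒⨯-multiple : ∀ {l x y} → ¬ l ≈ᵥ 0ᵥ → l · x ≈ 0# → l · y ≈ 0#
                           → ∃ λ d → x ⨯ y ≈ᵥ d *ᵥ l
  common-normal⇒⨯-multiple {l} {x} {y} l≉0 l·x≈0 l·y≈0 =
    ⨯-zero⇒multiple (x ⨯ y) l (≈ᵥ-trans (⨯-⨯ x y l) (vanish , vanish , vanish)) l≉0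
    where
    vanish : ∀ {a b} → (l · x) * a - (l · y) * b ≈ 0#
    vanish = zero-combination _ _ l·x≈0 l·y≈0

  common-normals⇒∥⊎∥ : ∀ {l m x y} → ¬ l ≈ᵥ 0ᵥ → ¬ m ≈ᵥ 0ᵥ → ¬ x ≈ᵥ 0ᵥ → ¬ y ≈ᵥ 0ᵥ
                     → l · x ≈ 0# → l · y ≈ 0# → m · x ≈ 0# → m · y ≈ 0# → l ∥ m ⊎ x ∥ y
  common-normals⇒∥⊎∥ {l} {m} {x} {y} l≉0 m≉0 x≉0 y≉0 l·x≈0 l·y≈0 m·x≈0 m·y≈0
    with IsZero? (x ⨯ y)
  ... | yes x⨯y≈0 = inj₂ (multiple⇒∥ x≉0 (⨯-zero⇒multiple x y x⨯y≈0 y≉0))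
  ... | no  x⨯y≉0 = inj₁ (∥-trans (∥-sym (x⨯y∥ l≉0 l·x≈0 l·y≈0)) (x⨯y∥ m≉0 m·x≈0 m·y≈0))
    where
    x⨯y∥ : ∀ {n} → ¬ n ≈ᵥ 0ᵥ → n · x ≈ 0# → n · y ≈ 0# → x ⨯ y ∥ n
    x⨯y∥ n≉0 n·x≈0 n·y≈0 = multiple⇒∥ x⨯y≉0 (common-normal⇒⨯-multiple n≉0 n·x≈0 n·y≈0)

  Independent : Vec3 → Vec3 → Set (c ⊔ ℓ)
  Independent u v = ∀ s k → s *ᵥ u +ᵥ k *ᵥ v ≈ᵥ 0ᵥ → s ≈ 0# × k ≈ 0#

  separated⇒independent : ∀ {u v w} → ¬ u ≈ᵥ 0ᵥ → u · w ≈ 0# → ¬ v · w ≈ 0# → Independent u v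
  separated⇒independent {u} {v} {w} u≉0 u·w≈0 v·w≉0 s k comb≈0@(p , q , r) = s≈0 , k≈0
    where
    k≈0 : k ≈ 0#
    k≈0 = x*y≈0⇒x≈0 v·w≉0 (begin
      k * (v · w)                  ≈⟨ +-identityˡ _ ⟨
      0# + k * (v · w)             ≈⟨ +-congʳ (trans (*-congˡ u·w≈0) (zeroʳ s)) ⟨
      s * (u · w) + k * (v · w)    ≈⟨ +-cong (·-*ᵥˡ s u w) (·-*ᵥˡ k v w) ⟨
      (s *ᵥ u) · w + (k *ᵥ v) · w  ≈⟨ ·-+ᵥˡ (s *ᵥ u) (k *ᵥ v) w ⟨
      (s *ᵥ u +ᵥ k *ᵥ v) · w       ≈⟨ ·-cong comb≈0 ≈ᵥ-refl ⟩
      0ᵥ · w                       ≈⟨ 0ᵥ-· w ⟩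
      0#                           ∎)
    drop : ∀ {a b} → s * a + k * b ≈ 0# → s * a ≈ 0#
    drop {a} {b} h = trans (sym (trans (+-congˡ (trans (*-congʳ k≈0) (zeroˡ b))) (+-identityʳ _))) h
    s≈0 : s ≈ 0#
    s≈0 = *ᵥ-zero u≉0 (drop p , drop q , drop r)

  ⨯-nonzero : ∀ {l x e} → ¬ x ≈ᵥ 0ᵥ → l · x ≈ 0# → ¬ l · e ≈ 0# → ¬ x ⨯ e ≈ᵥ 0ᵥ
  ⨯-nonzero {l} {x} {e} x≉0 l·x≈0 l·e≉0 x⨯e≈0 = x≉0 (zero-multiple d≈0 x≈de)
    where
    e≉0 : ¬ e ≈ᵥ 0ᵥ
    e≉0 e≈0 = l·e≉0 (trans (·-comm l e) (trans (·-cong e≈0 ≈ᵥ-refl) (0ᵥ-· l)))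
    d = proj₁ (⨯-zero⇒multiple x e x⨯e≈0 e≉0)
    x≈de = proj₂ (⨯-zero⇒multiple x e x⨯e≈0 e≉0)
    d≈0 : d ≈ 0#
    d≈0 = x*y≈0⇒x≈0 l·e≉0 (trans (sym (·-*ᵥʳ d l e)) (trans (·-cong ≈ᵥ-refl (≈ᵥ-sym x≈de)) l·x≈0))

  module Pencil {l w : Vec3} (independence : Independent w l) where
    member : Carrier → Vec3
    member k = k *ᵥ l +ᵥ w

    member-nonzero : ∀ k → ¬ member k ≈ᵥ 0ᵥ
    member-nonzero k (p , q , r) = 1≉0 (proj₁ (independence 1# k (coord p , coord q , coord r)))
      where
      coord : ∀ {a b} → k * a + b ≈ 0# → 1# * b + k * a ≈ 0#
      coord {a} {b} h = trans (solve 3 (λ k a b → con (+ 1) :* b :+ k :* a := k :* a :+ b) refl k a b) h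

    base-not-member : ∀ k → ¬ l ∥ member k
    base-not-member k (μ , μ≉0 , p , q , r) =
      μ≉0 (proj₁ (independence μ (μ * k - 1#) (coord p , coord q , coord r)))
      where
      coord : ∀ {a b} → a ≈ μ * (k * a + b) → μ * b + (μ * k - 1#) * a ≈ 0#
      coord {a} {b} h = trans
        (solve 4 (λ μ k a b → μ :* b :+ (μ :* k :- con (+ 1)) :* a := μ :* (k :* a :+ b) :- a) refl μ k a b)
        (x≈y⇒x-y≈0 (sym h))

    member-injective : ∀ {k k′} → member k ∥ member k′ → k ≈ k′
    member-injective {k} {k′} (μ , _ , p , q , r) = begin
      k         ≈⟨ x-y≈0⇒x≈y (proj₂ coefficients≈0) ⟩
      μ * k′    ≈⟨ *-congʳ (x-y≈0⇒x≈y (proj₁ coefficients≈0)) ⟨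
      1# * k′   ≈⟨ *-identityˡ k′ ⟩
      k′        ∎
      where
      coord : ∀ {a b} → k * a + b ≈ μ * (k′ * a + b) → (1# - μ) * b + (k - μ * k′) * a ≈ 0#
      coord {a} {b} h = trans
        (solve 5 (λ μ k k′ a b → (con (+ 1) :- μ) :* b :+ (k :- μ :* k′) :* a
                                 := (k :* a :+ b) :- μ :* (k′ :* a :+ b)) refl μ k k′ a b)
        (x≈y⇒x-y≈0 h)
      coefficients≈0 = independence (1# - μ) (k - μ * k′) (coord p , coord q , coord r)

module ProjectivePlane {c ℓ : Level} (F : FiniteField c ℓ) where
  open FiniteField F
  open Vector3 cring
  open FieldVectors F
  open PG F using (Point; Line; _≋_; _∈ₗ_)
  open import Relation.Binary.Reasoning.Setoid setoid

  two-lines-meet-once : ∀ P Q L M → P ∈ₗ L → Q ∈ₗ L → P ∈ₗ M → Q ∈ₗ M → L ≋ M ⊎ P ≋ Q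
  two-lines-meet-once P Q L M =
    common-normals⇒∥⊎∥ (proj₂ L) (proj₂ M) (proj₂ P) (proj₂ Q)

  -- For a fixed e ∉ L, the lines through X ∈ L other than L are k l + x ⨯ e (k ∈ F),
  -- x ⨯ e being the line joining X and e.
  module LinesThrough (L : Line) where
    private
      l = proj₁ L
      e = proj₁ (nonorthogonal l (proj₂ L))
      l·e≉0 : ¬ l · e ≈ 0#
      l·e≉0 l·e≈0 = proj₂ (nonorthogonal l (proj₂ L)) (trans (·-comm e l) l·e≈0)

      independent-of-L : ∀ X → X ∈ₗ L → Independent (proj₁ X ⨯ e) l
      independent-of-L (x , x≉0) x∈L =
        separated⇒independent (⨯-nonzero x≉0 x∈L l·e≉0) (⨯-orthogonalʳ x e) l·e≉0

      module PencilAt X X∈L = Pencil (independent-of-L X X∈L)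

    pencil : (X : Point) → X ∈ₗ L → Carrier → Line
    pencil X X∈L k = PencilAt.member X X∈L k , PencilAt.member-nonzero X X∈L k

    ∈-pencil : ∀ X (X∈L : X ∈ₗ L) k → X ∈ₗ pencil X X∈L k
    ∈-pencil (x , _) x∈L k = begin
      (k *ᵥ l +ᵥ x ⨯ e) · x          ≈⟨ ·-+ᵥˡ (k *ᵥ l) (x ⨯ e) x ⟩
      (k *ᵥ l) · x + (x ⨯ e) · x     ≈⟨ +-cong (·-*ᵥˡ k l x) (⨯-orthogonalˡ x e) ⟩
      k * (l · x) + 0#               ≈⟨ +-identityʳ _ ⟩
      k * (l · x)                    ≈⟨ *-congˡ x∈L ⟩
      k * 0#                         ≈⟨ zeroʳ k ⟩
      0#                             ∎

    L≉pencil : ∀ X (X∈L : X ∈ₗ L) k → ¬ L ≋ pencil X X∈L k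
    L≉pencil X X∈L = PencilAt.base-not-member X X∈L

    pencil-injective : ∀ X (X∈L : X ∈ₗ L) {k k′} → pencil X X∈L k ≋ pencil X X∈L k′ → k ≈ k′
    pencil-injective X X∈L = PencilAt.member-injective X X∈L

  q : ℕ
  q = order

  Code : Set
  Code = Fin q × Fin q ⊎ Fin q ⊎ Fin 1

  private
    element : Fin q → Carrier
    element = lookup elements

    index : Carrier → Fin q
    index a = Any.index (complete a)

    scaled : ∀ {x x′} y → x * x′ ≈ 1# → y ≈ x * element (index (x′ * y))
    scaled {x} {x′} y xx′≈1 =
      trans (x*x′≈1⇒y≈x′*[x*y] y (trans (*-comm x′ x) xx′≈1)) (*-congˡ (lookup-index (complete (x′ * y))))

    vanishing : ∀ {x} y → x ≈ 0# → x ≈ y * 0#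
    vanishing y x≈0 = trans x≈0 (sym (zeroʳ y))

  representative : Code → Vec3
  representative (inj₁ (i , j))  = 1# , element i , element j
  representative (inj₂ (inj₁ i)) = 0# , 1# , element i
  representative (inj₂ (inj₂ _)) = 0# , 0# , 1#

  classify : (P : Point) → Σ Code λ κ → proj₁ P ∥ representative κ
  classify ((x , y , z) , P≉0) with x ≟ 0# | y ≟ 0# | z ≟ 0#
  ... | no x≉0 | _ | _ =
    let x′ , xx′≈1 = inverse x x≉0 in
    inj₁ (index (x′ * y) , index (x′ * z)) , x , x≉0 , sym (*-identityʳ x) , scaled y xx′≈1 , scaled z xx′≈1
  ... | yes x≈0 | no y≉0 | _ =
    let y′ , yy′≈1 = inverse y y≉0 in
    inj₂ (inj₁ (index (y′ * z))) , y , y≉0 , vanishing y x≈0 , sym (*-identityʳ y) , scaled z yy′≈1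
  ... | yes x≈0 | yes y≈0 | no z≉0 =
    inj₂ (inj₂ Fin.zero) , z , z≉0 , vanishing z x≈0 , vanishing z y≈0 , sym (*-identityʳ z)
  ... | yes x≈0 | yes y≈0 | yes z≈0 = ⊥-elim (P≉0 (x≈0 , y≈0 , z≈0))

  code : Point → Code
  code P = proj₁ (classify P)

  code-injective : ∀ P Q → code P ≡ code Q → P ≋ Q
  code-injective P Q κP≡κQ =
    ∥-trans (proj₂ (classify P))
            (≡.subst (λ κ → representative κ ∥ proj₁ Q) (≡.sym κP≡κQ) (∥-sym (proj₂ (classify Q))))

  Fin↔Code : Fin (q ℕ.* q ℕ.+ (q ℕ.+ 1)) ↔ Code
  Fin↔Code = (*↔× ⊎-↔ +↔⊎) ↔-∘ +↔⊎

  distinct-points-bound : ∀ {Ps} → AllPairs (λ P Q → ¬ P ≋ Q) Ps → length Ps ℕ.≤ q ℕ.* q ℕ.+ (q ℕ.+ 1)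
  distinct-points-bound = AllPairs-length≤ (Injection.to toFin ∘ code)
    (λ {P} {Q} P≉Q eq → P≉Q (code-injective P Q (Injection.injective toFin eq)))
    where toFin = ↔⇒↣ (↔-sym Fin↔Code)

open import Data.Nat using (ℕ; _+_; _*_; _∸_; _≤_; _<_)

module _ {a p : Level} {A : Set a} {P : Pred A p} (P? : Decidable P) where

  sum-map-if : ∀ m n xs →
    sum (map (λ x → if does (P? x) then m else n) xs) + length (filter P? xs) * n
      ≡ length xs * n + length (filter P? xs) * m
  sum-map-if m n []       = ≡.refl
  sum-map-if m n (x ∷ xs) with does (P? x)
  ... | true  = ≡.trans (shuffle₁ m _ n _) (≡.trans (≡.cong ((m + n) +_) (sum-map-if m n xs)) (shuffle₂ m n _ _))
    where
    shuffle₁ : ∀ a b c d → (a + b) + (c + d) ≡ (a + c) + (b + d)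
    shuffle₁ = solve-∀
    shuffle₂ : ∀ a b c d → (a + b) + (c + d) ≡ (b + c) + (a + d)
    shuffle₂ = solve-∀
  ... | false = ≡.trans (ℕ.+-assoc n _ _) (≡.trans (≡.cong (n +_) (sum-map-if m n xs)) (≡.sym (ℕ.+-assoc n _ _)))

quasiarc-arithmetic : ∀ q t k n S → suc S ≤ q * q + (q + 1) → S + k * t ≡ n * t + k * q
                    → t * n ≤ t * k + (q + 1 ∸ k) * q
quasiarc-arithmetic q t k n S lines≤ counted = ℕ.+-cancelʳ-≤ (k * q) (t * n) _ (begin
  t * n + k * q                      ≡⟨ ≡.cong (_+ k * q) (ℕ.*-comm t n) ⟩
  n * t + k * q                      ≡⟨ counted ⟨
  S + k * t                          ≤⟨ ℕ.+-monoˡ-≤ (k * t) (ℕ.s≤s⁻¹ (≡.subst (suc S ≤_) (e₁ q) lines≤)) ⟩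
  (q * q + q) + k * t                ≡⟨ e₂ q t k ⟩
  t * k + (q + 1) * q                ≤⟨ ℕ.+-monoʳ-≤ (t * k) (ℕ.*-monoˡ-≤ q (ℕ.m≤n+m∸n (q + 1) k)) ⟩
  t * k + (k + (q + 1 ∸ k)) * q      ≡⟨ e₃ q t k (q + 1 ∸ k) ⟩
  (t * k + (q + 1 ∸ k) * q) + k * q  ∎)
  where
  open ℕ.≤-Reasoning
  e₁ : ∀ q → q * q + (q + 1) ≡ suc (q * q + q)
  e₁ = solve-∀
  e₂ : ∀ q t k → (q * q + q) + k * t ≡ t * k + (q + 1) * q
  e₂ = solve-∀
  e₃ : ∀ q t k d → t * k + (k + d) * q ≡ (t * k + d * q) + k * q
  e₃ = solve-∀

module QuasiarcBound {c ℓ : Level} (F : FiniteField c ℓ) (t : ℕ)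
                     (Ψ : PG.PointSet F) (quasiarc : PG.Quasiarc F t Ψ) (L : PG.Line F) where
  open FiniteField F using (elements; distinct)
  open PG F
  open FieldVectors F using (∥-sym; ·-zero-respˡ-∥)
  open ProjectivePlane F using (q; two-lines-meet-once; distinct-points-bound; module LinesThrough)
  open LinesThrough L

  _≉_ : Point → Point → Set (c ⊔ ℓ)
  P ≉ Q = ¬ P ≋ Q

  OwnLine : Point → Line → Set (c ⊔ ℓ)
  OwnLine X M = X ∈ pts Ψ × X ∈ₗ M × L ≉ M × (Tangent Ψ X M ⊎ X ∈ₗ L)

  own-lines-separate : ∀ {X Y M N} → X ≉ Y → OwnLine X M → OwnLine Y N → M ≉ N
  own-lines-separate X≉Y (_ , _ , _ , inj₁ tangent) (Y∈Ψ , Y∈N , _ , _) M≋N =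
    X≉Y (∥-sym (proj₂ tangent _ Y∈Ψ (·-zero-respˡ-∥ (∥-sym M≋N) Y∈N)))
  own-lines-separate X≉Y (X∈Ψ , X∈M , _ , inj₂ _) (_ , _ , _ , inj₁ tangent) M≋N =
    X≉Y (proj₂ tangent _ X∈Ψ (·-zero-respˡ-∥ M≋N X∈M))
  own-lines-separate {X} {Y} {M} X≉Y (_ , X∈M , L≉M , inj₂ X∈L) (_ , Y∈N , _ , inj₂ Y∈L) M≋N =
    [ L≉M , X≉Y ] (two-lines-meet-once X Y L M X∈L Y∈L X∈M (·-zero-respˡ-∥ (∥-sym M≋N) Y∈N))

  weight : Point → ℕ
  weight X = if does (X ∈ₗ? L) then q else t

  open Gathering _≉_ _≉_ OwnLine weight

  own-lines : ∀ X → X ∈ pts Ψ → (X∈L? : Dec (X ∈ₗ L))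
            → Σ (List Line) λ Ms → length Ms ≡ (if does X∈L? then q else t)
                                 × AllPairs _≉_ Ms × All (OwnLine X) Ms
  own-lines X X∈Ψ (yes X∈L) =
      map (pencil X X∈L) elements
    , length-map _ elements
    , AllPairs.map⁺ (AllPairs.map (λ k≉k′ → k≉k′ ∘ pencil-injective X X∈L) distinct)
    , All.map⁺ (All.universal (λ k → X∈Ψ , ∈-pencil X X∈L k , L≉pencil X X∈L k , inj₂ X∈L) elements)
  own-lines X X∈Ψ (no X∉L) with quasiarc X X∈Ψ
  ... | Ms , |Ms|≡t , distinct-tangents , tangents =
    -- Implicit points and lines are passed explicitly: incidence and ≋ only constrain
    -- coordinates, never the proof of nonzeroness.
    Ms , |Ms|≡t , distinct-tangents , All.map (λ {M} → owned {M}) tangents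
    where
    owned : ∀ {M} → Tangent Ψ X M → OwnLine X M
    owned tangent@(X∈M , _) = X∈Ψ , X∈M , (λ L≋M → X∉L (·-zero-respˡ-∥ (∥-sym L≋M) X∈M)) , inj₁ tangent

  families : All Family (pts Ψ)
  families = All.tabulate (λ {X} X∈Ψ → own-lines X X∈Ψ (X ∈ₗ? L))

  counted-lines-distinct : AllPairs _≉_ (L ∷ gather families)
  counted-lines-distinct =
      gather-All (λ {_} {M} _ (_ , _ , L≉M , _) → L≉M) (All.universal (λ _ → tt) (pts Ψ)) families
    ∷ gather-AllPairs (λ {X} {Y} {M} {N} → own-lines-separate {X} {Y} {M} {N}) (uniq Ψ) families

  counted-lines-bound : suc (sum (map weight (pts Ψ))) ≤ q * q + (q + 1)
  counted-lines-bound =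
    ≡.subst (λ n → suc n ≤ _) (length-gather families) (distinct-points-bound counted-lines-distinct)

  weights-sum : sum (map weight (pts Ψ)) + meet L Ψ * t ≡ card Ψ * t + meet L Ψ * q
  weights-sum = sum-map-if (_∈ₗ? L) q t (pts Ψ)

proposition2p5 : {c ℓ : Level} (F : FiniteField c ℓ) (t : ℕ) → 0 < t
    → (Ψ : PG.PointSet F) → PG.Quasiarc F t Ψ
    → (L : PG.Line F) (k : ℕ) → PG.meet F L Ψ ≡ k
    → t * PG.card F Ψ ≤ t * k + (FiniteField.order F + 1 ∸ k) * FiniteField.order F
proposition2p5 F t _ Ψ quasiarc L _ ≡.refl =
  quasiarc-arithmetic (FiniteField.order F) t (PG.meet F L Ψ) (PG.card F Ψ) _ counted-lines-bound weights-sum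
  where open QuasiarcBound F t Ψ quasiarc L
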